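{- Let $s\ge 3$ and $m\ge 1$ be integers, $n=sm+s-1$, and let $\mathcal F_1,\ldots,\mathcal F_s\subset 2^{[n]}$ be cross-dependent up-sets. Let $H_1,\ldots,H_s$ be pairwise disjoint $m$-element subsets of $[n]$, let $R=[n]\setminus\bigcup_{i=1}^sH_i$ (so $|R|=s-1$), and for each $i$ let $\emptyset=H_i^{(0)}\subsetneq H_i^{(1)}\subsetneq\cdots\subsetneq H_i^{(m)}=H_i$ be a full chain. For $0\le j\le m$ and $S\subset R$ let $\beta_i^{(j)}=1$ if $H_i^{(j)}\in\mathcal F_i$ and $0$ otherwise, and $\beta_i(S)=1$ if $H_i\cup S\in\mathcal F_i$ and $0$ otherwise. Then $$\sum_{i=1}^s\Biggl[\sum_{j=0}^m\binom nj\beta_i^{(j)}+\sum_{S\in\binom R1\cup\binom R2}\frac{\binom{n}{m+|S|}}{\binom{s-1}{|S|}}\beta_i(S)\Biggr]\le s\binom{n}{m+1}+s\binom{n}{m+2}.$$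
   Context: Families $\mathcal F_1,\ldots,\mathcal F_s$ are cross-dependent if there is no choice of pairwise disjoint $F_1\in\mathcal F_1,\ldots,F_s\in\mathcal F_s$. A family $\mathcal F\subset2^{[n]}$ is an up-set if every superset (within $[n]$) of a member of $\mathcal F$ belongs to $\mathcal F$. -}

module Defs where

open import Data.Bool using (Bool; true; false; if_then_else_)
open import Data.Nat using (ℕ; zero; suc)
open import Data.Nat.Combinatorics using (_C_)
open import Data.Integer using (+_)
open import Data.Rational using (ℚ; 0ℚ; 1ℚ; _+_; _/_)
open import Data.Fin using (Fin; zero; suc)
open import Data.Fin.Subset using (Subset; _⊆_; _∩_; Empty; ∁; ∣_∣; outside; inside)
open import Data.Vec using (_∷_; [])
open import Data.List using (List; []; _∷_; map; _++_; foldr)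
open import Relation.Nullary using (¬_)
open import Relation.Binary.PropositionalEquality using (_≡_; _≢_)
open import Data.Product using (Σ; _×_)

Family : ℕ → Set
Family n = Subset n → Bool

_∈F_ : ∀ {n} → Subset n → Family n → Set
A ∈F F = F A ≡ true

UpSet : ∀ {n} → Family n → Set
UpSet F = ∀ A B → A ⊆ B → A ∈F F → B ∈F F

CrossDependent : ∀ {s n} → (Fin s → Family n) → Set
CrossDependent {s} {n} F =
  ¬ (Σ (Fin s → Subset n) λ G →
       (∀ i → G i ∈F F i) × (∀ i j → i ≢ j → Empty (G i ∩ G j)))

⋃Fin : ∀ {s n} → (Fin s → Subset n) → Subset n
⋃Fin {zero} H = Data.Fin.Subset.⊥
⋃Fin {suc s} H = H zero Data.Fin.Subset.∪ ⋃Fin (λ i → H (suc i))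

allSubsets : (n : ℕ) → List (Subset n)
allSubsets zero = [] ∷ []
allSubsets (suc n) = map (outside ∷_) (allSubsets n) ++ map (inside ∷_) (allSubsets n)

sumList : List ℚ → ℚ
sumList = foldr _+_ 0ℚ

sumFin : ∀ {k} → (Fin k → ℚ) → ℚ
sumFin {zero} f = 0ℚ
sumFin {suc k} f = f zero + sumFin (λ i → f (suc i))

ℕ→ℚ : ℕ → ℚ
ℕ→ℚ a = + a / 1

-- a / d as a rational (only used with d ≠ 0; returns 0 if d = 0)
frac : ℕ → ℕ → ℚ
frac a zero = 0ℚ
frac a (suc d) = + a / suc d

β : ∀ {n} → Family n → Subset n → ℚ
β F A = if F A then 1ℚ else 0ℚ

open import Data.List using (filter)
open import Data.Sum using (_⊎_)
open import Data.Fin.Subset.Properties using (_⊆?_)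
open import Relation.Nullary.Decidable using (_×-dec_; _⊎-dec_)
open import Data.Nat using (_≟_)

Small : ∀ {n} → Subset n → Subset n → Set
Small R S = S ⊆ R × (∣ S ∣ ≡ 1 ⊎ ∣ S ∣ ≡ 2)

smallSubsets : ∀ {n} → Subset n → List (Subset n)
smallSubsets {n} R = filter (λ S → (S ⊆? R) ×-dec ((∣ S ∣ ≟ 1) ⊎-dec (∣ S ∣ ≟ 2))) (allSubsets n)

-- Let c = C(n,m), P = C(n,m+2) and G = Σ_{j≤m} C(n,j). Because n = sm+s−1, the weight of a
-- singleton S is exactly c, the weights of the C(s−1,2) pairs add up to P, and the binomial
-- coefficients grow so fast below m that (s−2)G ≤ (s−1)c ≤ P. Since F_i is an up-set, the chain of
-- agent i contributes at most G, and nothing unless H_i ∈ F_i; its singletons contribute c per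
-- point x ∈ R with H_i ∪ {x} ∈ F_i, and its pairs at most P. Cross-dependence forbids extending
-- every H_i inside R to a member of F_i with the extensions pairwise disjoint. Hence either some
-- agent with H_i ∉ F_i has no extension at all, contributes nothing, and the others fit into the
-- bound; or at least two agents have H_i ∉ F_i and they cannot be matched to distinct points of R,
-- so by a deficiency form of Hall's theorem their missing singleton terms amount to at least
-- (s−1)c ≥ (s−2)G, which pays for the chains of the remaining agents.

module Submission where

module Binomial where

  open import Data.Nat
  open import Data.Nat.Properties
  open import Data.Nat.Combinatorics using (_C_; nC1≡n; nCk+nC[k+1]≡[n+1]C[k+1])
  open import Data.Nat.Solver using (module +-*-Solver)
  open import Data.Fin using (toℕ)
  open import Data.Fin.Properties using (toℕ-inject₁; toℕ-fromℕ)
  open import Relation.Binary.PropositionalEquality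
  open import Algebra.Properties.Semiring.Sum +-*-semiring using (sum-syntax; sum-init-last; sum-cong-≗)
  open +-*-Solver

  C-pascal : ∀ n k → suc n C suc k ≡ n C k + n C suc k
  C-pascal n k = sym (nCk+nC[k+1]≡[n+1]C[k+1] n k)

  C-absorb : ∀ n k → suc k * (suc n C suc k) ≡ suc n * (n C k)
  C-absorb n zero = trans (+-identityʳ _) (trans (nC1≡n (suc n)) (sym (*-identityʳ (suc n))))
  C-absorb zero (suc k) = *-zeroʳ (suc (suc k))
  C-absorb (suc n) (suc k) = begin
    (2 + k) * (suc (suc n) C (2 + k))          ≡⟨ cong ((2 + k) *_) (C-pascal (suc n) (suc k)) ⟩
    (2 + k) * (x + y)                           ≡⟨ solve 3 (λ k x y → (con 2 :+ k) :* (x :+ y)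
                                                     := x :+ ((con 1 :+ k) :* x :+ (con 2 :+ k) :* y)) refl k x y ⟩
    x + ((1 + k) * x + (2 + k) * y)             ≡⟨ cong (x +_) (cong₂ _+_ (C-absorb n k) (C-absorb n (suc k))) ⟩
    x + ((1 + n) * (n C k) + (1 + n) * (n C suc k)) ≡⟨ cong (x +_) (sym (*-distribˡ-+ (1 + n) (n C k) (n C suc k))) ⟩
    x + (1 + n) * (n C k + n C suc k)           ≡⟨ cong (λ z → x + (1 + n) * z) (sym (C-pascal n k)) ⟩
    (2 + n) * x                                 ∎
    where
    open ≡-Reasoning
    x = suc n C suc k
    y = suc n C (2 + k)

  -- (k+1)·C(n,k+1) = (n−k)·C(n,k), with the subtraction moved to the other side.
  C-ratio : ∀ n k → suc k * (n C suc k) + k * (n C k) ≡ n * (n C k)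
  C-ratio zero zero = refl
  C-ratio zero (suc k) = cong₂ _+_ (*-zeroʳ (2 + k)) (*-zeroʳ (suc k))
  C-ratio (suc n) zero = trans (+-identityʳ _) (C-absorb n 0)
  C-ratio (suc n) (suc k) = begin
    (2 + k) * (suc n C (2 + k)) + (1 + k) * (suc n C suc k) ≡⟨ cong₂ _+_ (C-absorb n (suc k)) (C-absorb n k) ⟩
    (1 + n) * (n C suc k) + (1 + n) * (n C k)              ≡⟨ sym (*-distribˡ-+ (1 + n) (n C suc k) (n C k)) ⟩
    (1 + n) * (n C suc k + n C k)                          ≡⟨ cong ((1 + n) *_) (trans (+-comm (n C suc k) (n C k)) (sym (C-pascal n k))) ⟩
    (1 + n) * (suc n C suc k)                              ∎
    where open ≡-Reasoning

  C-step-≡ : ∀ {n k q} → suc q * suc k + k ≡ n → n C suc k ≡ suc q * (n C k)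
  C-step-≡ {n} {k} {q} eq = *-cancelˡ-≡ (n C suc k) (suc q * b) (suc k) (+-cancelʳ-≡ (k * b) (suc k * (n C suc k)) (suc k * (suc q * b)) (begin
    suc k * (n C suc k) + k * b   ≡⟨ C-ratio n k ⟩
    n * b                         ≡⟨ cong (_* b) (sym eq) ⟩
    (suc q * suc k + k) * b       ≡⟨ solve 4 (λ q k b k' → (q :* k :+ k') :* b := k :* (q :* b) :+ k' :* b) refl (suc q) (suc k) b k ⟩
    suc k * (suc q * b) + k * b   ∎))
    where
    open ≡-Reasoning
    b = n C k

  C-step-≤ : ∀ {n k q} → suc q * suc k + k ≤ n → suc q * (n C k) ≤ n C suc k
  C-step-≤ {n} {k} {q} le = *-cancelˡ-≤ (suc k) (+-cancelʳ-≤ (k * b) (suc k * (suc q * b)) (suc k * (n C suc k)) (begin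
    suc k * (suc q * b) + k * b   ≡⟨ solve 4 (λ q k b k' → k :* (q :* b) :+ k' :* b := (q :* k :+ k') :* b) refl (suc q) (suc k) b k ⟩
    (suc q * suc k + k) * b       ≤⟨ *-monoˡ-≤ b le ⟩
    n * b                         ≡⟨ sym (C-ratio n k) ⟩
    suc k * (n C suc k) + k * b   ∎))
    where
    open ≤-Reasoning
    b = n C k

  ∑-toℕ-last : ∀ (f : ℕ → ℕ) k → ∑[ j < suc k ] f (toℕ j) ≡ ∑[ j < k ] f (toℕ j) + f k
  ∑-toℕ-last f k = trans (sum-init-last {k} (λ j → f (toℕ j)))
    (cong₂ _+_ (sum-cong-≗ {k} (λ j → cong f (toℕ-inject₁ j))) (cong f (toℕ-fromℕ k)))

  geometric-≤ : ∀ q (f : ℕ → ℕ) k → (∀ j → j < k → suc q * f j ≤ f (suc j)) →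
                q * ∑[ j < k ] f (toℕ j) ≤ f k
  geometric-≤ q f zero grow = subst (_≤ f 0) (sym (*-zeroʳ q)) z≤n
  geometric-≤ q f (suc k) grow = begin
    q * ∑[ j < suc k ] f (toℕ j)         ≡⟨ cong (q *_) (∑-toℕ-last f k) ⟩
    q * (∑[ j < k ] f (toℕ j) + f k)     ≡⟨ *-distribˡ-+ q _ (f k) ⟩
    q * ∑[ j < k ] f (toℕ j) + q * f k   ≤⟨ +-monoˡ-≤ (q * f k) (geometric-≤ q f k (λ j j<k → grow j (m<n⇒m<1+n j<k))) ⟩
    f k + q * f k                        ≤⟨ grow k ≤-refl ⟩
    f (suc k)                            ∎
    where open ≤-Reasoning

  module Budget (t m′ : ℕ) where

    s r m n : ℕ
    s = 3 + t
    r = 2 + t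
    m = suc m′
    n = s * m + r

    n≡r*[m+1]+m : r * suc m + m ≡ n
    n≡r*[m+1]+m = solve 2 (λ t m′ → (con 2 :+ t) :* (con 2 :+ m′) :+ (con 1 :+ m′)
                             := (con 3 :+ t) :* (con 1 :+ m′) :+ (con 2 :+ t)) refl t m′

    C-grows-below-m : ∀ j → j < m → r * (n C j) ≤ n C suc j
    C-grows-below-m j j<m = C-step-≤ {n} {j} {1 + t} (subst (r * suc j + j ≤_) n≡r*[m+1]+m
                              (+-mono-≤ (*-monoʳ-≤ r (s≤s j≤m)) j≤m))
      where j≤m = <⇒≤ j<m

    -- Opaque, so that conversion checking never unfolds these binomial coefficients.
    opaque
      c P G : ℕ
      c = n C m
      P = n C (m + 2)
      G = ∑[ j < suc m ] (n C toℕ j)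

      C[n,m+2]≡P : n C (m + 2) ≡ P
      C[n,m+2]≡P = refl

      G≡∑ : G ≡ ∑[ j < suc m ] (n C toℕ j)
      G≡∑ = refl

      C[n,m+1]≡r*c : n C (m + 1) ≡ r * c
      C[n,m+1]≡r*c = trans (cong (n C_) (+-comm m 1)) (C-step-≡ {n} {m} {1 + t} n≡r*[m+1]+m)

      r*c≤P : r * c ≤ P
      r*c≤P = begin
        r * c           ≡⟨ sym C[n,m+1]≡r*c ⟩
        n C (m + 1)     ≡⟨ cong (n C_) (+-comm m 1) ⟩
        n C suc m       ≡⟨ sym (+-identityʳ _) ⟩
        1 * (n C suc m) ≤⟨ C-step-≤ {n} {suc m} {0} (subst (1 * suc (suc m) + suc m ≤_) n≡ (m≤m+n _ _)) ⟩
        n C suc (suc m) ≡⟨ cong (n C_) (+-comm 2 m) ⟩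
        P               ∎
        where
        open ≤-Reasoning
        n≡ : 1 * suc (suc m) + suc m + (m′ + t * m′ + 2 * t) ≡ n
        n≡ = solve 2 (λ t m′ → (con 1 :* (con 3 :+ m′) :+ (con 2 :+ m′)) :+ (m′ :+ t :* m′ :+ con 2 :* t)
                       := (con 3 :+ t) :* (con 1 :+ m′) :+ (con 2 :+ t)) refl t m′

      [r∸1]*G≤r*c : (1 + t) * G ≤ r * c
      [r∸1]*G≤r*c = begin
        (1 + t) * G                          ≡⟨ cong ((1 + t) *_) (∑-toℕ-last (n C_) m) ⟩
        (1 + t) * (∑[ j < m ] (n C toℕ j) + c) ≡⟨ *-distribˡ-+ (1 + t) (∑[ j < m ] (n C toℕ j)) c ⟩
        (1 + t) * ∑[ j < m ] (n C toℕ j) + (1 + t) * c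
          ≤⟨ +-monoˡ-≤ ((1 + t) * c) (geometric-≤ (1 + t) (n C_) m C-grows-below-m) ⟩
        c + (1 + t) * c                      ∎
        where open ≤-Reasoning

    r*G≤r*c+P : r * G ≤ r * c + P
    r*G≤r*c+P = begin
      r * G              ≡⟨ +-comm G ((1 + t) * G) ⟩
      (1 + t) * G + G    ≤⟨ +-mono-≤ [r∸1]*G≤r*c (≤-trans (m≤n*m G (1 + t)) (≤-trans [r∸1]*G≤r*c r*c≤P)) ⟩
      r * c + P          ∎
      where open ≤-Reasoning

    r*[G+r*c+P]≤s*[r*c+P] : r * (G + (r * c + P)) ≤ s * (r * c + P)
    r*[G+r*c+P]≤s*[r*c+P] = begin
      r * (G + (r * c + P))         ≡⟨ *-distribˡ-+ r G (r * c + P) ⟩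
      r * G + r * (r * c + P)       ≤⟨ +-monoˡ-≤ (r * (r * c + P)) r*G≤r*c+P ⟩
      (r * c + P) + r * (r * c + P) ∎
      where open ≤-Reasoning


module Summation where

  open import Data.Bool using (Bool; true; false; if_then_else_)
  open import Data.Nat hiding (_≟_)
  open import Data.Nat.Properties hiding (_≟_)
  open import Data.Empty using (⊥-elim)
  open import Data.Fin using (Fin; zero; suc; punchIn; _≟_)
  open import Data.Fin.Properties using (punchInᵢ≢i)
  open import Data.Product using (∃; _,_)
  open import Data.List using ([]; _∷_; map; filter)
  open import Data.List.Relation.Unary.All using (All; []; _∷_)
  import Data.Integer as ℤ
  import Data.Integer.Properties as ℤ
  import Data.Rational as ℚ
  import Data.Rational.Properties as ℚ
  import Data.Rational.Unnormalised as ℚᵘ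
  import Data.Rational.Unnormalised.Properties as ℚᵘ
  open import Relation.Nullary using (does; yes; no)
  open import Relation.Unary using (Pred; Decidable)
  open import Relation.Binary.PropositionalEquality
  open import Level using (0ℓ)
  import Data.Rational.Solver as ℚ-Solver
  module QS = ℚ-Solver.+-*-Solver
  open import Algebra.Properties.Semiring.Sum +-*-semiring
    using (sum; sum-syntax; sum-cong-≗; sum-remove)
  open import Data.Nat.ListAction using () renaming (sum to sumℕ)
  open import Defs using (ℕ→ℚ; frac; sumFin; sumList)

  ⟦_⟧ : Bool → ℕ
  ⟦ true ⟧ = 1
  ⟦ false ⟧ = 0

  ⟦⟧-mono : ∀ {a b} → (a ≡ true → b ≡ true) → ⟦ a ⟧ ≤ ⟦ b ⟧
  ⟦⟧-mono {false} _ = z≤n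
  ⟦⟧-mono {true} a⇒b rewrite a⇒b refl = ≤-refl

  if-≤ : ∀ b {a} → (if b then a else 0) ≤ a
  if-≤ true = ≤-refl
  if-≤ false = z≤n

  ⟦⟧*-≤ : ∀ b a → ⟦ b ⟧ * a ≤ a
  ⟦⟧*-≤ true a = ≤-reflexive (+-identityʳ a)
  ⟦⟧*-≤ false a = z≤n

  ∑-mono-≤ : ∀ {k} {f g : Fin k → ℕ} → (∀ i → f i ≤ g i) → sum f ≤ sum g
  ∑-mono-≤ {zero} f≤g = z≤n
  ∑-mono-≤ {suc k} f≤g = +-mono-≤ (f≤g zero) (∑-mono-≤ (λ i → f≤g (suc i)))

  ∑-const : ∀ k c → ∑[ i < k ] c ≡ k * c
  ∑-const zero c = refl
  ∑-const (suc k) c = cong (c +_) (∑-const k c)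

  _without_ : ∀ {k} → (Fin k → ℕ) → Fin k → Fin k → ℕ
  (f without y) i = if does (i ≟ y) then 0 else f i

  without-self : ∀ {k} (f : Fin k → ℕ) y → (f without y) y ≡ 0
  without-self f y with y ≟ y
  ... | yes _ = refl
  ... | no y≢y = ⊥-elim (y≢y refl)

  without-punchIn : ∀ {k} (f : Fin (suc k) → ℕ) y i → (f without y) (punchIn y i) ≡ f (punchIn y i)
  without-punchIn f y i with punchIn y i ≟ y
  ... | yes eq = ⊥-elim (punchInᵢ≢i y i eq)
  ... | no _ = refl

  ∑-pick : ∀ {k} (f : Fin k → ℕ) y → sum f ≡ f y + sum (f without y)
  ∑-pick {suc k} f y = begin
    sum f                                  ≡⟨ sum-remove {i = y} f ⟩
    f y + sum (λ i → f (punchIn y i))      ≡⟨ cong (f y +_) (sum-cong-≗ (λ i → sym (without-punchIn f y i))) ⟩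
    f y + sum (λ i → (f without y) (punchIn y i)) ≡⟨ cong (f y +_) (sym (trans (sum-remove {i = y} (f without y)) (cong (_+ sum (λ i → (f without y) (punchIn y i))) (without-self f y)))) ⟩
    f y + sum (f without y)                ∎
    where open ≡-Reasoning

  ∑-pos : ∀ {k} (f : Fin k → ℕ) → 0 < sum f → ∃ λ i → 0 < f i
  ∑-pos {suc k} f pos with f zero in eq
  ... | suc _ = zero , subst (0 <_) (sym eq) (s≤s z≤n)
  ... | zero with ∑-pos (λ i → f (suc i)) pos
  ...   | i , p = suc i , p

  ℕ→ℚ-toℚᵘ : ∀ a → ℚ.toℚᵘ (ℕ→ℚ a) ℚᵘ.≃ ℚᵘ.mkℚᵘ (ℤ.+ a) 0
  ℕ→ℚ-toℚᵘ a = ℚ.toℚᵘ-fromℚᵘ (ℚᵘ.mkℚᵘ (ℤ.+ a) 0)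

  frac-toℚᵘ : ∀ a d → ℚ.toℚᵘ (frac a (suc d)) ℚᵘ.≃ ℚᵘ.mkℚᵘ (ℤ.+ a) d
  frac-toℚᵘ a d = ℚ.toℚᵘ-fromℚᵘ (ℚᵘ.mkℚᵘ (ℤ.+ a) d)

  ℕ→ℚ-+ : ∀ a b → ℕ→ℚ (a + b) ≡ ℕ→ℚ a ℚ.+ ℕ→ℚ b
  ℕ→ℚ-+ a b = ℚ.toℚᵘ-injective (ℚᵘ.≃-trans (ℕ→ℚ-toℚᵘ (a + b)) (ℚᵘ.≃-trans sum≃
    (ℚᵘ.≃-sym (ℚᵘ.≃-trans (ℚ.toℚᵘ-homo-+ (ℕ→ℚ a) (ℕ→ℚ b)) (ℚᵘ.+-cong (ℕ→ℚ-toℚᵘ a) (ℕ→ℚ-toℚᵘ b))))))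
    where
    sum≃ : ℚᵘ.mkℚᵘ (ℤ.+ (a + b)) 0 ℚᵘ.≃ ℚᵘ.mkℚᵘ (ℤ.+ a) 0 ℚᵘ.+ ℚᵘ.mkℚᵘ (ℤ.+ b) 0
    sum≃ = ℚᵘ.*≡* (cong (ℤ._* ℤ.+ 1) (sym (cong₂ ℤ._+_ (ℤ.*-identityʳ (ℤ.+ a)) (ℤ.*-identityʳ (ℤ.+ b)))))

  ℕ→ℚ-mono-≤ : ∀ {a b} → a ≤ b → ℕ→ℚ a ℚ.≤ ℕ→ℚ b
  ℕ→ℚ-mono-≤ {a} {b} a≤b = ℚ.toℚᵘ-cancel-≤ (ℚᵘ.≤-respˡ-≃ (ℚᵘ.≃-sym (ℕ→ℚ-toℚᵘ a))
    (ℚᵘ.≤-respʳ-≃ (ℚᵘ.≃-sym (ℕ→ℚ-toℚᵘ b)) (ℚᵘ.*≤* (ℤ.*-monoʳ-≤-nonNeg (ℤ.+ 1) (ℤ.+≤+ a≤b)))))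

  frac-nonNeg : ∀ a d → ℚ.0ℚ ℚ.≤ frac a d
  frac-nonNeg a zero = ℚ.≤-refl
  frac-nonNeg a (suc d) = ℚ.toℚᵘ-cancel-≤ (ℚᵘ.≤-respʳ-≃ (ℚᵘ.≃-sym (frac-toℚᵘ a d))
    (ℚᵘ.*≤* (subst (ℤ.+ 0 ℤ.≤_) (sym (ℤ.*-identityʳ (ℤ.+ a))) (ℤ.+≤+ z≤n))))

  frac-*-denominator : ∀ a d → d ≢ 0 → frac a d ℚ.* ℕ→ℚ d ≡ ℕ→ℚ a
  frac-*-denominator a zero d≢0 = ⊥-elim (d≢0 refl)
  frac-*-denominator a (suc d) _ = ℚ.toℚᵘ-injective (ℚᵘ.≃-trans (ℚ.toℚᵘ-homo-* (frac a (suc d)) (ℕ→ℚ (suc d)))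
    (ℚᵘ.≃-trans (ℚᵘ.*-cong (frac-toℚᵘ a d) (ℕ→ℚ-toℚᵘ (suc d))) (ℚᵘ.≃-trans cancel≃ (ℚᵘ.≃-sym (ℕ→ℚ-toℚᵘ a)))))
    where
    cancel≃ : ℚᵘ.mkℚᵘ (ℤ.+ a) d ℚᵘ.* ℚᵘ.mkℚᵘ (ℤ.+ suc d) 0 ℚᵘ.≃ ℚᵘ.mkℚᵘ (ℤ.+ a) 0
    cancel≃ = ℚᵘ.*≡* (trans (ℤ.*-identityʳ _) (trans (sym (ℤ.pos-* a (suc d)))
      (trans (cong (λ z → ℤ.+ (a * z)) (sym (*-identityʳ (suc d)))) (ℤ.pos-* a (suc (d * 1))))))

  frac-cancel : ∀ d c → frac (suc d * c) (suc d) ≡ ℕ→ℚ c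
  frac-cancel d c = ℚ.toℚᵘ-injective (ℚᵘ.≃-trans (frac-toℚᵘ (suc d * c) d) (ℚᵘ.≃-trans cancel≃ (ℚᵘ.≃-sym (ℕ→ℚ-toℚᵘ c))))
    where
    cancel≃ : ℚᵘ.mkℚᵘ (ℤ.+ (suc d * c)) d ℚᵘ.≃ ℚᵘ.mkℚᵘ (ℤ.+ c) 0
    cancel≃ = ℚᵘ.*≡* (trans (ℤ.*-identityʳ _) (trans (cong ℤ.+_ (*-comm (suc d) c)) (ℤ.pos-* c (suc d))))

  ℕ→ℚ-*-indicator : ∀ a b → ℕ→ℚ a ℚ.* (if b then ℚ.1ℚ else ℚ.0ℚ) ≡ ℕ→ℚ (a * ⟦ b ⟧)
  ℕ→ℚ-*-indicator a true = trans (ℚ.*-identityʳ (ℕ→ℚ a)) (cong ℕ→ℚ (sym (*-identityʳ a)))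
  ℕ→ℚ-*-indicator a false = trans (ℚ.*-zeroʳ (ℕ→ℚ a)) (cong ℕ→ℚ (sym (*-zeroʳ a)))

  *-indicator-≤ : ∀ x b → ℚ.0ℚ ℚ.≤ x → x ℚ.* (if b then ℚ.1ℚ else ℚ.0ℚ) ℚ.≤ x
  *-indicator-≤ x true _ = ℚ.≤-reflexive (ℚ.*-identityʳ x)
  *-indicator-≤ x false 0≤x = subst (ℚ._≤ x) (sym (ℚ.*-zeroʳ x)) 0≤x

  sumFin-mono-≤ : ∀ {k} {f g : Fin k → ℚ.ℚ} → (∀ i → f i ℚ.≤ g i) → sumFin f ℚ.≤ sumFin g
  sumFin-mono-≤ {zero} f≤g = ℚ.≤-refl
  sumFin-mono-≤ {suc k} f≤g = ℚ.+-mono-≤ (f≤g zero) (sumFin-mono-≤ (λ i → f≤g (suc i)))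

  sumFin-ℕ→ℚ : ∀ {k} (f : Fin k → ℕ) → sumFin (λ i → ℕ→ℚ (f i)) ≡ ℕ→ℚ (sum f)
  sumFin-ℕ→ℚ {zero} f = refl
  sumFin-ℕ→ℚ {suc k} f = trans (cong (ℕ→ℚ (f zero) ℚ.+_) (sumFin-ℕ→ℚ (λ i → f (suc i)))) (sym (ℕ→ℚ-+ (f zero) _))

  sumFin-≤-ℕ : ∀ {k} (X : Fin k → ℚ.ℚ) (Y : Fin k → ℕ) N →
               (∀ i → X i ℚ.≤ ℕ→ℚ (Y i)) → sum Y ≤ N → sumFin X ℚ.≤ ℕ→ℚ N
  sumFin-≤-ℕ X Y N X≤Y ΣY≤N = ℚ.≤-trans (sumFin-mono-≤ X≤Y)
    (ℚ.≤-trans (ℚ.≤-reflexive (sumFin-ℕ→ℚ Y)) (ℕ→ℚ-mono-≤ {sum Y} {N} ΣY≤N))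

  sumList-mono-≤ : ∀ {A : Set} {f g : A → ℚ.ℚ} {xs} → All (λ x → f x ℚ.≤ g x) xs →
                   sumList (map f xs) ℚ.≤ sumList (map g xs)
  sumList-mono-≤ [] = ℚ.≤-refl
  sumList-mono-≤ (fx≤gx ∷ f≤g) = ℚ.+-mono-≤ fx≤gx (sumList-mono-≤ f≤g)

  sumList-ℕ→ℚ-linear : ∀ {A : Set} (a b : A → ℕ) w xs →
    sumList (map (λ x → ℕ→ℚ (a x) ℚ.+ w ℚ.* ℕ→ℚ (b x)) xs)
      ≡ ℕ→ℚ (sumℕ (map a xs)) ℚ.+ w ℚ.* ℕ→ℚ (sumℕ (map b xs))
  sumList-ℕ→ℚ-linear a b w [] = sym (trans (cong (ℚ.0ℚ ℚ.+_) (ℚ.*-zeroʳ w)) (ℚ.+-identityʳ ℚ.0ℚ))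
  sumList-ℕ→ℚ-linear a b w (x ∷ xs) = begin
    (A₁ ℚ.+ w ℚ.* B₁) ℚ.+ sumList (map (λ x → ℕ→ℚ (a x) ℚ.+ w ℚ.* ℕ→ℚ (b x)) xs)
      ≡⟨ cong ((A₁ ℚ.+ w ℚ.* B₁) ℚ.+_) (sumList-ℕ→ℚ-linear a b w xs) ⟩
    (A₁ ℚ.+ w ℚ.* B₁) ℚ.+ (Aₛ ℚ.+ w ℚ.* Bₛ)
      ≡⟨ QS.solve 5 (λ a₁ b₁ aₛ bₛ w → (a₁ QS.:+ w QS.:* b₁) QS.:+ (aₛ QS.:+ w QS.:* bₛ)
                     QS.:= (a₁ QS.:+ aₛ) QS.:+ w QS.:* (b₁ QS.:+ bₛ)) refl A₁ B₁ Aₛ Bₛ w ⟩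
    (A₁ ℚ.+ Aₛ) ℚ.+ w ℚ.* (B₁ ℚ.+ Bₛ)
      ≡⟨ sym (cong₂ (λ u v → u ℚ.+ w ℚ.* v) (ℕ→ℚ-+ (a x) _) (ℕ→ℚ-+ (b x) _)) ⟩
    ℕ→ℚ (a x + sumℕ (map a xs)) ℚ.+ w ℚ.* ℕ→ℚ (b x + sumℕ (map b xs)) ∎
    where
    open ≡-Reasoning
    A₁ = ℕ→ℚ (a x)
    B₁ = ℕ→ℚ (b x)
    Aₛ = ℕ→ℚ (sumℕ (map a xs))
    Bₛ = ℕ→ℚ (sumℕ (map b xs))

  sumList-map-zero : ∀ {A : Set} {f : A → ℚ.ℚ} {xs} → All (λ x → f x ≡ ℚ.0ℚ) xs → sumList (map f xs) ≡ ℚ.0ℚ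
  sumList-map-zero [] = refl
  sumList-map-zero (fx≡0 ∷ f≡0) = trans (cong₂ ℚ._+_ fx≡0 (sumList-map-zero f≡0)) (ℚ.+-identityʳ ℚ.0ℚ)

  sumℕ-filter : ∀ {A : Set} {P : Pred A 0ℓ} (P? : Decidable P) (f : A → ℕ) xs →
    sumℕ (map f (filter P? xs)) ≡ sumℕ (map (λ x → if does (P? x) then f x else 0) xs)
  sumℕ-filter P? f [] = refl
  sumℕ-filter P? f (x ∷ xs) with does (P? x)
  ... | true = cong (f x +_) (sumℕ-filter P? f xs)
  ... | false = sumℕ-filter P? f xs


module Subsets where

  open import Data.Bool using (true; false; if_then_else_; _∧_)
  open import Data.Nat hiding (_≟_)
  open import Data.Nat.Properties using (+-suc; +-identityʳ; +-comm; +-*-semiring)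
  open import Data.Empty using (⊥-elim)
  import Data.Nat as ℕ
  open import Data.Nat.Combinatorics using (_C_)
  open import Data.Nat.ListAction using () renaming (sum to sumℕ)
  open import Data.Nat.ListAction.Properties using () renaming (sum-++ to sumℕ-++)
  open import Data.Fin using (Fin; zero; suc; inject₁; fromℕ)
  open import Data.Fin.Properties using (suc-injective)
  open import Data.Fin.Subset
    using (Subset; inside; outside; _∈_; _⊆_; _∩_; _∪_; ∣_∣; ⁅_⁆; Empty) renaming (⊥ to ∅)
  open import Data.Fin.Subset.Properties using (_⊆?_; x∈p∪q⁺; x∈p∪q⁻; x∈p∩q⁺; x∈p∩q⁻; drop-∷-Empty; ∣⊥∣≡0; ∉⊥; ⊆-trans; x∈⁅y⁆⇒x≡y)
  open import Data.Vec using ([]; _∷_; here; lookup)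
  open import Data.List using ([]; _∷_; map; _++_)
  open import Data.List.Properties using (map-++; map-∘)
  open import Data.Product using (∃; _,_; proj₁; proj₂)
  open import Data.Sum using (inj₁; inj₂)
  open import Relation.Nullary using (does)
  open import Relation.Binary.PropositionalEquality
  open import Algebra.Properties.Semiring.Sum +-*-semiring using (sum-syntax)
  open import Defs using (⋃Fin; allSubsets)
  open Binomial using (C-pascal)
  open Summation using (⟦_⟧)

  private variable
    n : ℕ

  ∈-⋃Fin⁺ : ∀ {s} (H : Fin s → Subset n) {x} i → x ∈ H i → x ∈ ⋃Fin H
  ∈-⋃Fin⁺ H zero x∈H₀ = x∈p∪q⁺ (inj₁ x∈H₀)
  ∈-⋃Fin⁺ H (suc i) x∈Hᵢ = x∈p∪q⁺ (inj₂ (∈-⋃Fin⁺ (λ j → H (suc j)) i x∈Hᵢ))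

  ∈-⋃Fin⁻ : ∀ {s} (H : Fin s → Subset n) {x} → x ∈ ⋃Fin H → ∃ λ i → x ∈ H i
  ∈-⋃Fin⁻ {s = zero} H x∈∅ = ⊥-elim (∉⊥ x∈∅)
  ∈-⋃Fin⁻ {s = suc s} H x∈⋃ with x∈p∪q⁻ (H zero) _ x∈⋃
  ... | inj₁ x∈H₀ = zero , x∈H₀
  ... | inj₂ x∈⋃′ with ∈-⋃Fin⁻ (λ j → H (suc j)) x∈⋃′
  ...   | i , x∈Hᵢ = suc i , x∈Hᵢ

  ∣p∪q∣≡∣p∣+∣q∣ : ∀ (p q : Subset n) → Empty (p ∩ q) → ∣ p ∪ q ∣ ≡ ∣ p ∣ + ∣ q ∣
  ∣p∪q∣≡∣p∣+∣q∣ [] [] _ = refl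
  ∣p∪q∣≡∣p∣+∣q∣ (outside ∷ p) (outside ∷ q) disj = ∣p∪q∣≡∣p∣+∣q∣ p q (drop-∷-Empty disj)
  ∣p∪q∣≡∣p∣+∣q∣ (outside ∷ p) (inside ∷ q) disj =
    trans (cong suc (∣p∪q∣≡∣p∣+∣q∣ p q (drop-∷-Empty disj))) (sym (+-suc ∣ p ∣ ∣ q ∣))
  ∣p∪q∣≡∣p∣+∣q∣ (inside ∷ p) (outside ∷ q) disj = cong suc (∣p∪q∣≡∣p∣+∣q∣ p q (drop-∷-Empty disj))
  ∣p∪q∣≡∣p∣+∣q∣ (inside ∷ p) (inside ∷ q) disj = ⊥-elim (disj (zero , here))

  ∣⋃Fin∣ : ∀ {s m} (H : Fin s → Subset n) → (∀ i → ∣ H i ∣ ≡ m) →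
           (∀ i j → i ≢ j → Empty (H i ∩ H j)) → ∣ ⋃Fin H ∣ ≡ s * m
  ∣⋃Fin∣ {n} {zero} H _ _ = ∣⊥∣≡0 n
  ∣⋃Fin∣ {n} {suc s} {m} H ∣H∣≡m disj = begin
    ∣ H zero ∪ ⋃Fin H′ ∣        ≡⟨ ∣p∪q∣≡∣p∣+∣q∣ (H zero) (⋃Fin H′) H₀-disjoint ⟩
    ∣ H zero ∣ + ∣ ⋃Fin H′ ∣    ≡⟨ cong₂ _+_ (∣H∣≡m zero) (∣⋃Fin∣ H′ (λ i → ∣H∣≡m (suc i)) disj′) ⟩
    m + s * m                   ∎
    where
    open ≡-Reasoning
    H′ = λ i → H (suc i)
    disj′ : ∀ i j → i ≢ j → Empty (H′ i ∩ H′ j)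
    disj′ i j i≢j = disj (suc i) (suc j) (λ eq → i≢j (suc-injective eq))
    H₀-disjoint : Empty (H zero ∩ ⋃Fin H′)
    H₀-disjoint (x , x∈∩) with x∈p∩q⁻ (H zero) (⋃Fin H′) x∈∩
    ... | x∈H₀ , x∈⋃ with ∈-⋃Fin⁻ H′ x∈⋃
    ...   | i , x∈Hᵢ = disj zero (suc i) (λ ()) (x , x∈p∩q⁺ (x∈H₀ , x∈Hᵢ))

  sumℕ-map-zero : ∀ {A : Set} (f : A → ℕ) xs → (∀ x → f x ≡ 0) → sumℕ (map f xs) ≡ 0
  sumℕ-map-zero f [] _ = refl
  sumℕ-map-zero f (x ∷ xs) f≡0 = cong₂ _+_ (f≡0 x) (sumℕ-map-zero f xs f≡0)

  sumℕ-allSubsets : ∀ n (f : Subset (suc n) → ℕ) → sumℕ (map f (allSubsets (suc n)))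
    ≡ sumℕ (map (λ S → f (outside ∷ S)) (allSubsets n)) + sumℕ (map (λ S → f (inside ∷ S)) (allSubsets n))
  sumℕ-allSubsets n f = begin
    sumℕ (map f (map (outside ∷_) Ss ++ map (inside ∷_) Ss))
      ≡⟨ cong sumℕ (map-++ f (map (outside ∷_) Ss) (map (inside ∷_) Ss)) ⟩
    sumℕ (map f (map (outside ∷_) Ss) ++ map f (map (inside ∷_) Ss))
      ≡⟨ sumℕ-++ (map f (map (outside ∷_) Ss)) _ ⟩
    sumℕ (map f (map (outside ∷_) Ss)) + sumℕ (map f (map (inside ∷_) Ss))
      ≡⟨ sym (cong₂ (λ u v → sumℕ u + sumℕ v) (map-∘ Ss) (map-∘ Ss)) ⟩
    sumℕ (map (λ S → f (outside ∷ S)) Ss) + sumℕ (map (λ S → f (inside ∷ S)) Ss) ∎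
    where
    open ≡-Reasoning
    Ss = allSubsets n

  #subsets-of-size : ∀ {n} (R : Subset n) k →
    sumℕ (map (λ S → ⟦ does (S ⊆? R) ∧ does (∣ S ∣ ℕ.≟ k) ⟧) (allSubsets n)) ≡ ∣ R ∣ C k
  #subsets-of-size [] zero = refl
  #subsets-of-size [] (suc k) = refl
  #subsets-of-size {suc n} (outside ∷ R) k = trans (sumℕ-allSubsets n _)
    (trans (cong₂ _+_ (#subsets-of-size R k) (sumℕ-map-zero _ (allSubsets n) (λ _ → refl))) (+-identityʳ _))
  #subsets-of-size {suc n} (inside ∷ R) zero = trans (sumℕ-allSubsets n _)
    (trans (cong₂ _+_ (#subsets-of-size R zero) (sumℕ-map-zero _ (allSubsets n) size≢0)) (+-identityʳ _))
    where
    size≢0 : ∀ S → ⟦ does (S ⊆? R) ∧ false ⟧ ≡ 0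
    size≢0 S with does (S ⊆? R)
    ... | true = refl
    ... | false = refl
  #subsets-of-size {suc n} (inside ∷ R) (suc k) = trans (sumℕ-allSubsets n _)
    (trans (cong₂ _+_ (#subsets-of-size R (suc k)) (#subsets-of-size R k))
           (trans (+-comm (∣ R ∣ C suc k) (∣ R ∣ C k)) (sym (C-pascal ∣ R ∣ k))))

  sum-over-empty-subset : ∀ {n} (R : Subset n) (h : Subset n → ℕ) →
    sumℕ (map (λ S → if does (S ⊆? R) ∧ does (∣ S ∣ ℕ.≟ 0) then h S else 0) (allSubsets n)) ≡ h ∅
  sum-over-empty-subset [] h = +-identityʳ _
  sum-over-empty-subset {suc n} (x ∷ R) h = trans (sumℕ-allSubsets n _)
    (trans (cong₂ _+_ (sum-over-empty-subset R (λ S → h (outside ∷ S))) (sumℕ-map-zero _ (allSubsets n) size≢0))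
           (+-identityʳ _))
    where
    size≢0 : ∀ S → (if does ((inside ∷ S) ⊆? (x ∷ R)) ∧ false then h (inside ∷ S) else 0) ≡ 0
    size≢0 S with does ((inside ∷ S) ⊆? (x ∷ R))
    ... | true = refl
    ... | false = refl

  sum-over-singletons : ∀ {n} (R : Subset n) (h : Subset n → ℕ) →
    sumℕ (map (λ S → if does (S ⊆? R) ∧ does (∣ S ∣ ℕ.≟ 1) then h S else 0) (allSubsets n))
      ≡ ∑[ x < n ] (if lookup R x then h ⁅ x ⁆ else 0)
  sum-over-singletons [] h = refl
  sum-over-singletons {suc n} (outside ∷ R) h = trans (sumℕ-allSubsets n _)
    (trans (cong₂ _+_ (sum-over-singletons R (λ S → h (outside ∷ S))) (sumℕ-map-zero _ (allSubsets n) (λ _ → refl)))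
           (+-identityʳ _))
  sum-over-singletons {suc n} (inside ∷ R) h = trans (sumℕ-allSubsets n _)
    (trans (cong₂ _+_ (sum-over-singletons R (λ S → h (outside ∷ S))) (sum-over-empty-subset R (λ S → h (inside ∷ S))))
           (+-comm _ (h (inside ∷ ∅))))

  chain⊆last : ∀ {n m} (f : Fin (suc m) → Subset n) → (∀ (j : Fin m) → f (inject₁ j) ⊆ f (suc j)) →
               ∀ j → f j ⊆ f (fromℕ m)
  chain⊆last {m = zero} f step zero = λ x∈ → x∈
  chain⊆last {m = suc m} f step zero = ⊆-trans (step zero) (chain⊆last (λ k → f (suc k)) (λ j → step (suc j)) zero)
  chain⊆last {m = suc m} f step (suc j) = chain⊆last (λ k → f (suc k)) (λ j → step (suc j)) j

  Empty-∅∩ : ∀ {n} {p : Subset n} q → p ≡ ∅ → Empty (p ∩ q)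
  Empty-∅∩ q refl (x , x∈) = ∉⊥ (proj₁ (x∈p∩q⁻ ∅ q x∈))

  Empty-∩∅ : ∀ {n} p {q : Subset n} → q ≡ ∅ → Empty (p ∩ q)
  Empty-∩∅ p refl (x , x∈) = ∉⊥ (proj₂ (x∈p∩q⁻ p ∅ x∈))

  Empty-⁅⁆∩⁅⁆ : ∀ {n} {x y : Fin n} → x ≢ y → Empty (⁅ x ⁆ ∩ ⁅ y ⁆)
  Empty-⁅⁆∩⁅⁆ {x = x} {y} x≢y (z , z∈) with x∈p∩q⁻ ⁅ x ⁆ ⁅ y ⁆ z∈
  ... | z∈x , z∈y = x≢y (trans (sym (x∈⁅y⁆⇒x≡y x z∈x)) (x∈⁅y⁆⇒x≡y y z∈y))


module Matching where

  open import Data.Bool using (Bool; true; false; if_then_else_; _∧_; not)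
  open import Data.Vec using ([]; _∷_; lookup)
  open import Data.Fin.Subset using (Subset; inside; outside; ∣_∣)
  open import Data.Bool.Properties using (∧-conicalˡ; ∧-conicalʳ) renaming (_≟_ to _≟ᵇ_)
  open import Data.Nat hiding (_≟_)
  open import Data.Nat.Properties using (module ≤-Reasoning; ≤-reflexive; ≤-trans; ≤-refl; *-identityʳ; m≤m+n; +-mono-≤; suc-injective; n≢0⇒n>0; +-*-semiring)
  import Data.Nat as ℕ
  open import Data.Fin using (Fin; _≟_)
  open import Data.Fin.Properties using (any?)
  open import Data.Product using (Σ; ∃; _×_; _,_; proj₁; proj₂)
  open import Data.Empty using (⊥-elim)
  open import Relation.Nullary using (¬_; does; yes; no)
  open import Relation.Nullary.Decidable using (_×-dec_)
  open import Relation.Binary.PropositionalEquality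
  open import Algebra.Properties.Semiring.Sum +-*-semiring using (sum-syntax; sum-cong-≗; ∑-distrib-+)
  open Summation using (⟦_⟧; ∑-mono-≤; ∑-pick; ∑-pos; _without_; ∑-const)

  count : ∀ {k} → (Fin k → Bool) → ℕ
  count {k} A = ∑[ i < k ] ⟦ A i ⟧

  count-lookup : ∀ {n} (p : Subset n) → count (lookup p) ≡ ∣ p ∣
  count-lookup [] = refl
  count-lookup (outside ∷ p) = count-lookup p
  count-lookup (inside ∷ p) = cong suc (count-lookup p)

  count+count-not : ∀ {k} (A : Fin k → Bool) → count A + count (λ i → not (A i)) ≡ k
  count+count-not {k} A = begin
    count A + count (λ i → not (A i))      ≡⟨ sym (∑-distrib-+ (λ i → ⟦ A i ⟧) (λ i → ⟦ not (A i) ⟧)) ⟩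
    ∑[ i < k ] (⟦ A i ⟧ + ⟦ not (A i) ⟧)    ≡⟨ sum-cong-≗ (λ i → one (A i)) ⟩
    ∑[ i < k ] 1                           ≡⟨ ∑-const k 1 ⟩
    k * 1                                  ≡⟨ *-identityʳ k ⟩
    k                                      ∎
    where
    open ≡-Reasoning
    one : ∀ b → ⟦ b ⟧ + ⟦ not b ⟧ ≡ 1
    one true = refl
    one false = refl

  remove : ∀ {k} → (Fin k → Bool) → Fin k → Fin k → Bool
  remove A y i = if does (i ≟ y) then false else A i

  module _ {k} (A : Fin k → Bool) (y : Fin k) where

    remove-⊆ : ∀ i → remove A y i ≡ true → A i ≡ true
    remove-⊆ i r with i ≟ y
    ... | no _ = r

    remove-≢ : ∀ i → remove A y i ≡ true → i ≢ y
    remove-≢ i r with i ≟ y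
    ... | no i≢y = i≢y

    remove-intro : ∀ i → A i ≡ true → i ≢ y → remove A y i ≡ true
    remove-intro i Ai i≢y with i ≟ y
    ... | yes i≡y = ⊥-elim (i≢y i≡y)
    ... | no _ = Ai

    count-remove : A y ≡ true → count A ≡ suc (count (remove A y))
    count-remove Ay = trans (∑-pick (λ i → ⟦ A i ⟧) y) (cong₂ _+_ (cong ⟦_⟧ Ay) (sum-cong-≗ pointwise))
      where
      pointwise : ∀ i → ((λ i → ⟦ A i ⟧) without y) i ≡ ⟦ remove A y i ⟧
      pointwise i with i ≟ y
      ... | yes _ = refl
      ... | no _ = refl

  count-pos : ∀ {k} (A : Fin k → Bool) → 0 < count A → ∃ λ y → A y ≡ true
  count-pos A pos with ∑-pos (λ i → ⟦ A i ⟧) pos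
  ... | y , p with A y in Ay
  ...   | true = y , Ay

  count≤1⇒unique : ∀ {k} (A : Fin k → Bool) → count A ≤ 1 → ∀ i j → A i ≡ true → A j ≡ true → i ≡ j
  count≤1⇒unique A #A≤1 i j Ai Aj with i ≟ j
  ... | yes i≡j = i≡j
  ... | no i≢j with subst (_≤ 1) (trans (count-remove A i Ai) (cong suc (count-remove (remove A i) j Aj′))) #A≤1
    where Aj′ = remove-intro A i j Aj (λ j≡i → i≢j (sym j≡i))
  ...   | s≤s ()

  if-pos : ∀ b {a} → 0 < (if b then a else 0) → b ≡ true × 0 < a
  if-pos true pos = refl , pos

  module Hall {s n} (alive : Fin s → Fin n → Bool) where

    live dead : Fin s → (Fin n → Bool) → ℕ
    live i U = count (λ x → U x ∧ alive i x)
    dead i U = count (λ x → U x ∧ not (alive i x))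

    deficit : (Fin s → Bool) → (Fin n → Bool) → ℕ
    deficit A U = ∑[ i < s ] (if A i then dead i U else 0)

    SDR : (Fin s → Bool) → (Fin n → Bool) → Set
    SDR A U = Σ (Fin s → Fin n) λ f →
      (∀ i → A i ≡ true → U (f i) ≡ true × alive i (f i) ≡ true) ×
      (∀ i j → A i ≡ true → A j ≡ true → f i ≡ f j → i ≡ j)

    live+dead : ∀ i U → live i U + dead i U ≡ count U
    live+dead i U = trans (sym (∑-distrib-+ (λ x → ⟦ U x ∧ alive i x ⟧) (λ x → ⟦ U x ∧ not (alive i x) ⟧)))
                          (sum-cong-≗ pointwise)
      where
      pointwise : ∀ x → ⟦ U x ∧ alive i x ⟧ + ⟦ U x ∧ not (alive i x) ⟧ ≡ ⟦ U x ⟧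
      pointwise x with U x | alive i x
      ... | true | true = refl
      ... | true | false = refl
      ... | false | _ = refl

    dead-mono : ∀ i {V U} → (∀ x → V x ≡ true → U x ≡ true) → dead i V ≤ dead i U
    dead-mono i {V} {U} V⊆U = ∑-mono-≤ pointwise
      where
      pointwise : ∀ x → ⟦ V x ∧ not (alive i x) ⟧ ≤ ⟦ U x ∧ not (alive i x) ⟧
      pointwise x with V x in Vx
      ... | false = z≤n
      ... | true rewrite V⊆U x Vx = ≤-refl

    deficit-mono : ∀ A {V U} → (∀ x → V x ≡ true → U x ≡ true) → deficit A V ≤ deficit A U
    deficit-mono A V⊆U = ∑-mono-≤ pointwise
      where
      pointwise : ∀ i → (if A i then dead i _ else 0) ≤ (if A i then dead i _ else 0)
      pointwise i with A i
      ... | true = dead-mono i V⊆U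
      ... | false = z≤n

    deficit-remove : ∀ A U y → A y ≡ true → deficit A U ≡ dead y U + deficit (remove A y) U
    deficit-remove A U y Ay = trans (∑-pick _ y)
      (cong₂ _+_ (cong (λ b → if b then dead y U else 0) Ay) (sum-cong-≗ pointwise))
      where
      pointwise : ∀ i → ((λ i → if A i then dead i U else 0) without y) i ≡ (if remove A y i then dead i U else 0)
      pointwise i with i ≟ y
      ... | yes _ = refl
      ... | no _ = refl

    dead≤deficit : ∀ A U y → A y ≡ true → dead y U ≤ deficit A U
    dead≤deficit A U y Ay = subst (dead y U ≤_) (sym (deficit-remove A U y Ay)) (m≤m+n _ _)

    SDR-extend : ∀ A U y x → A y ≡ true → U x ≡ true → alive y x ≡ true →
                 SDR (remove A y) (remove U x) → SDR A U
    SDR-extend A U y x Ay Ux ax (f , f-alive , f-inj) = g , g-alive , g-inj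
      where
      g : Fin s → Fin n
      g i = if does (i ≟ y) then x else f i
      g-alive : ∀ i → A i ≡ true → U (g i) ≡ true × alive i (g i) ≡ true
      g-alive i Ai with i ≟ y
      ... | yes refl = Ux , ax
      ... | no i≢y = remove-⊆ U x (f i) (proj₁ fi) , proj₂ fi
        where fi = f-alive i (remove-intro A y i Ai i≢y)
      g-inj : ∀ i j → A i ≡ true → A j ≡ true → g i ≡ g j → i ≡ j
      g-inj i j Ai Aj gi≡gj with i ≟ y | j ≟ y
      ... | yes i≡y | yes j≡y = trans i≡y (sym j≡y)
      ... | yes _ | no j≢y = ⊥-elim (remove-≢ U x (f j) (proj₁ (f-alive j (remove-intro A y j Aj j≢y))) (sym gi≡gj))
      ... | no i≢y | yes _ = ⊥-elim (remove-≢ U x (f i) (proj₁ (f-alive i (remove-intro A y i Ai i≢y))) gi≡gj)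
      ... | no i≢y | no j≢y = f-inj i j (remove-intro A y i Ai i≢y) (remove-intro A y j Aj j≢y) gi≡gj

    -- A deficiency form of Hall's marriage theorem.
    hall-of-size : ∀ k A U → count A ≡ suc k → suc k ≤ count U → ¬ SDR A U → count U ≤ deficit A U
    hall-of-size k A U #A #A≤#U noSDR with any? (λ y → (A y ≟ᵇ true) ×-dec (live y U ℕ.≟ 0))
    ... | yes (y , Ay , live≡0) = begin
      count U             ≡⟨ sym (live+dead y U) ⟩
      live y U + dead y U ≡⟨ cong (_+ dead y U) live≡0 ⟩
      dead y U            ≤⟨ dead≤deficit A U y Ay ⟩
      deficit A U         ∎
      where open ≤-Reasoning
    ... | no no-isolated = matched k #A #A≤#U
      where
      representative : ∀ y → A y ≡ true → ∃ λ x → U x ≡ true × alive y x ≡ true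
      representative y Ay with count-pos (λ x → U x ∧ alive y x)
                                 (n≢0⇒n>0 (λ live≡0 → no-isolated (y , Ay , live≡0)))
      ... | x , p = x , ∧-conicalˡ (U x) (alive y x) p , ∧-conicalʳ (U x) (alive y x) p

      recurse : ∀ k → count A ≡ suc (suc k) → suc (suc k) ≤ count U → ∀ y → A y ≡ true →
                ∃ λ x → U x ≡ true × suc k ≤ count (remove U x) × count (remove U x) ≤ deficit (remove A y) U
      recurse k #A #A≤#U y Ay with representative y Ay
      ... | x , Ux , ax = x , Ux , k<#U-x , ≤-trans ih (deficit-mono (remove A y) (remove-⊆ U x))
        where
        k<#U-x : suc k ≤ count (remove U x)
        k<#U-x = s≤s⁻¹ (subst (suc (suc k) ≤_) (count-remove U x Ux) #A≤#U)
        ih = hall-of-size k (remove A y) (remove U x) (suc-injective (trans (sym (count-remove A y Ay)) #A)) k<#U-x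
                  (λ sdr → noSDR (SDR-extend A U y x Ay Ux ax sdr))

      matched : ∀ k → count A ≡ suc k → suc k ≤ count U → count U ≤ deficit A U
      matched zero #A≡1 _ with count-pos A (subst (0 <_) (sym #A≡1) (s≤s z≤n))
      ... | y , Ay with representative y Ay
      ...   | x , Ux , ax = ⊥-elim (noSDR ((λ _ → x) , x-alive , λ i j Ai Aj _ → trans (≡y i Ai) (sym (≡y j Aj))))
        where
        ≡y : ∀ i → A i ≡ true → i ≡ y
        ≡y i Ai = count≤1⇒unique A (≤-reflexive #A≡1) i y Ai Ay
        x-alive : ∀ i → A i ≡ true → U x ≡ true × alive i x ≡ true
        x-alive i Ai rewrite ≡y i Ai = Ux , ax
      matched (suc k) #A #A≤#U with count-pos A (subst (0 <_) (sym #A) (s≤s z≤n))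
      ... | y₀ , Ay₀ with recurse k #A #A≤#U y₀ Ay₀
      ...   | x₀ , _ , k<#U-x₀ , ih₀ with ∑-pos (λ i → if remove A y₀ i then dead i U else 0) (≤-trans (s≤s z≤n) (≤-trans k<#U-x₀ ih₀))
      ...     | y , pos with if-pos (remove A y₀ y) pos
      ...       | y∈A-y₀ , dead-pos with remove-⊆ A y₀ y y∈A-y₀
      ...         | Ay with recurse k #A #A≤#U y Ay
      ...           | x , Ux , _ , ih = begin
        count U                           ≡⟨ count-remove U x Ux ⟩
        suc (count (remove U x))          ≤⟨ +-mono-≤ dead-pos ih ⟩
        dead y U + deficit (remove A y) U ≡⟨ sym (deficit-remove A U y Ay) ⟩
        deficit A U                       ∎
        where open ≤-Reasoning

    hall : ∀ A U → 0 < count A → count A ≤ count U → ¬ SDR A U → count U ≤ deficit A U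
    hall A U pos #A≤#U noSDR with count A in #A
    ... | suc k = hall-of-size k A U #A #A≤#U noSDR


module Proof where

  open import Data.Bool using (Bool; true; false; if_then_else_; _∧_; _∨_; not)
  open import Data.Bool.Properties using (¬-not; not-injective) renaming (_≟_ to _≟ᵇ_)
  open import Data.Nat hiding (_≟_)
  open import Data.Nat.Properties
    using (≤-trans; ≤-reflexive; m≤m+n; +-mono-≤; +-monoˡ-≤; +-monoʳ-≤; *-monoʳ-≤; *-monoˡ-≤;
           +-comm; *-comm; *-zeroʳ; *-distribˡ-+; m+n∸m≡n; +-cancelˡ-≤; +-cancelˡ-≡;
           ≰⇒>; module ≤-Reasoning; +-*-semiring; 0≢1+n; m+n≡0⇒m≡0; +-cancelʳ-≤)
  open import Data.Nat.Solver using (module +-*-Solver)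
  open +-*-Solver using (solve; _:+_; _:=_)
  import Data.Nat as ℕ
  open import Data.Nat.Combinatorics using (_C_; nC1≡n)
  open import Data.Nat.ListAction using () renaming (sum to sumℕ)
  open import Data.Fin using (Fin; zero; suc; toℕ; fromℕ; inject₁; _≟_)
  open import Data.Fin.Properties using (any?)
  open import Data.Fin.Subset
    using (Subset; _∈_; _∉_; _⊆_; _⊂_; _∩_; _∪_; ∁; ∣_∣; ⁅_⁆; Empty) renaming (⊥ to ∅)
  open import Data.Fin.Subset.Properties
    using (_⊆?_; x∈p∩q⁺; x∈p∩q⁻; x∈p∪q⁻; p⊆p∪q; ⊆-min; x∈∁p⇒x∉p; x∈⁅y⁆⇒x≡y; ∣∁p∣≡n∸∣p∣; p⊂q⇒p⊆q)
  open import Data.Vec using (lookup)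
  open import Data.Vec.Properties using (lookup⇒[]=)
  open import Data.List using (map)
  open import Data.List.Properties using (map-cong)
  open import Data.List.Relation.Unary.All as All using (All; all?)
  open import Data.List.Relation.Unary.All.Properties using (¬All⇒Any¬; all-filter)
  import Data.List.Relation.Unary.Any as Any
  open import Data.Product using (Σ; ∃; _×_; _,_; proj₁; proj₂)
  open import Data.Sum using (inj₁; inj₂; _⊎_)
  open import Data.Empty using (⊥; ⊥-elim)
  open import Relation.Nullary using (¬_; does; yes; no; Dec)
  open import Relation.Nullary.Decidable using (_×-dec_; _⊎-dec_)
  open import Relation.Binary.PropositionalEquality
  import Data.Rational as ℚ
  import Data.Rational.Properties as ℚ
  open import Algebra.Properties.Semiring.Sum +-*-semiring using (sum; sum-syntax; sum-cong-≗; ∑-distrib-+; *-distribˡ-sum; *-distribʳ-sum)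
  open import Defs
  open Binomial
  open Summation
  open Subsets
  open Matching

  *-split-≤ : ∀ a l d e {k} → l + d ≡ k → e ≤ d → a * l + a * e ≤ k * a
  *-split-≤ a l d e {k} l+d≡k e≤d = begin
    a * l + a * e  ≤⟨ +-monoʳ-≤ (a * l) (*-monoʳ-≤ a e≤d) ⟩
    a * l + a * d  ≡⟨ sym (*-distribˡ-+ a l d) ⟩
    a * (l + d)    ≡⟨ cong (a *_) l+d≡k ⟩
    a * k          ≡⟨ *-comm a k ⟩
    k * a          ∎
    where open ≤-Reasoning

  module Setting (t m′ : ℕ) where

    open Budget t m′ public

    module Agents (F : Fin s → Family n) (up : ∀ i → UpSet (F i)) (cd : CrossDependent F)
                  (H : Fin s → Subset n) (∣H∣≡m : ∀ i → ∣ H i ∣ ≡ m)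
                  (H-disjoint : ∀ i j → i ≢ j → Empty (H i ∩ H j))
                  (Ch : Fin s → Fin (suc m) → Subset n) (Ch-top : ∀ i → Ch i (fromℕ m) ≡ H i)
                  (Ch-step : ∀ i (j : Fin m) → Ch i (inject₁ j) ⊂ Ch i (suc j)) where

      R : Subset n
      R = ∁ (⋃Fin H)

      ∣R∣≡r : ∣ R ∣ ≡ r
      ∣R∣≡r = begin
        ∣ ∁ (⋃Fin H) ∣     ≡⟨ ∣∁p∣≡n∸∣p∣ (⋃Fin H) ⟩
        n ∸ ∣ ⋃Fin H ∣     ≡⟨ cong (n ∸_) (∣⋃Fin∣ H ∣H∣≡m H-disjoint) ⟩
        n ∸ s * m          ≡⟨ m+n∸m≡n (s * m) r ⟩
        r                  ∎
        where open ≡-Reasoning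

      ∈R⇒∉H : ∀ {x} i → x ∈ R → x ∉ H i
      ∈R⇒∉H i x∈R x∈Hᵢ = x∈∁p⇒x∉p x∈R (∈-⋃Fin⁺ H i x∈Hᵢ)

      owns deficient : Fin s → Bool
      owns i = F i (H i)
      deficient i = not (owns i)

      alive : Fin s → Fin n → Bool
      alive i x = F i (H i ∪ ⁅ x ⁆)

      inR : Fin n → Bool
      inR = lookup R

      open Hall alive public

      Extension : Fin s → Subset n → Set
      Extension i T = T ⊆ R × F i (H i ∪ T) ≡ true

      no-disjoint-extensions : (T : Fin s → Subset n) → (∀ i → Extension i (T i)) →
                               (∀ i j → i ≢ j → Empty (T i ∩ T j)) → ⊥
      no-disjoint-extensions T ext T-disjoint = cd ((λ i → H i ∪ T i) , (λ i → proj₂ (ext i)) , disjoint)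
        where
        disjoint : ∀ i j → i ≢ j → Empty ((H i ∪ T i) ∩ (H j ∪ T j))
        disjoint i j i≢j (x , x∈∩) with x∈p∩q⁻ (H i ∪ T i) (H j ∪ T j) x∈∩
        ... | x∈i , x∈j with x∈p∪q⁻ (H i) (T i) x∈i | x∈p∪q⁻ (H j) (T j) x∈j
        ... | inj₁ x∈Hᵢ | inj₁ x∈Hⱼ = H-disjoint i j i≢j (x , x∈p∩q⁺ (x∈Hᵢ , x∈Hⱼ))
        ... | inj₁ x∈Hᵢ | inj₂ x∈Tⱼ = ∈R⇒∉H i (proj₁ (ext j) x∈Tⱼ) x∈Hᵢ
        ... | inj₂ x∈Tᵢ | inj₁ x∈Hⱼ = ∈R⇒∉H j (proj₁ (ext i) x∈Tᵢ) x∈Hⱼ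
        ... | inj₂ x∈Tᵢ | inj₂ x∈Tⱼ = T-disjoint i j i≢j (x , x∈p∩q⁺ (x∈Tᵢ , x∈Tⱼ))

      -- Owners are extended by ∅, so only the deficient agents need disjoint extensions.
      no-disjoint-deficient-extensions :
        (T : ∀ i → deficient i ≡ true → Subset n) → (∀ i di → Extension i (T i di)) →
        (∀ i j di dj → i ≢ j → Empty (T i di ∩ T j dj)) → ⊥
      no-disjoint-deficient-extensions T ext T-disjoint =
        no-disjoint-extensions (λ i → T′ i (deficient i) refl) (λ i → ext′ i (deficient i) refl) disjoint
        where
        T′ : ∀ i b → deficient i ≡ b → Subset n
        T′ i true di = T i di
        T′ i false _ = ∅
        ext′ : ∀ i b di → Extension i (T′ i b di)
        ext′ i true di = ext i di
        ext′ i false di with owns i in oi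
        ... | true = ⊆-min R , up i (H i) (H i ∪ ∅) (p⊆p∪q ∅) oi
        disjoint′ : ∀ i j → i ≢ j → ∀ bi bj di dj → Empty (T′ i bi di ∩ T′ j bj dj)
        disjoint′ i j i≢j true true di dj = T-disjoint i j di dj i≢j
        disjoint′ i j i≢j false bj di dj = Empty-∅∩ (T′ j bj dj) refl
        disjoint′ i j i≢j true false di dj = Empty-∩∅ (T i di) refl
        disjoint : ∀ i j → i ≢ j → Empty (T′ i (deficient i) refl ∩ T′ j (deficient j) refl)
        disjoint i j i≢j = disjoint′ i j i≢j (deficient i) (deficient j) refl refl

      at-most-one-deficient⇒⊥ : (∀ i → deficient i ≡ true → Σ (Subset n) (Extension i)) → count deficient ≤ 1 → ⊥
      at-most-one-deficient⇒⊥ ext #≤1 = no-disjoint-deficient-extensions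
        (λ i di → proj₁ (ext i di)) (λ i di → proj₂ (ext i di))
        (λ i j di dj i≢j → ⊥-elim (i≢j (count≤1⇒unique deficient #≤1 i j di dj)))

      deficient-unmatchable : ¬ SDR deficient inR
      deficient-unmatchable (f , f-alive , f-inj) = no-disjoint-deficient-extensions (λ i _ → ⁅ f i ⁆)
        (λ i di → ⁅⁆⊆R (proj₁ (f-alive i di)) , proj₂ (f-alive i di))
        (λ i j di dj i≢j → Empty-⁅⁆∩⁅⁆ (λ fi≡fj → i≢j (f-inj i j di dj fi≡fj)))
        where
        ⁅⁆⊆R : ∀ {x} → inR x ≡ true → ⁅ x ⁆ ⊆ R
        ⁅⁆⊆R {x} x∈R y∈⁅x⁆ rewrite x∈⁅y⁆⇒x≡y x y∈⁅x⁆ = lookup⇒[]= x R x∈R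

      #R≡r : count inR ≡ r
      #R≡r = trans (count-lookup R) ∣R∣≡r

      live≤r : ∀ i → live i inR ≤ r
      live≤r i = subst (live i inR ≤_) (trans (live+dead i inR) #R≡r) (m≤m+n _ _)

      chainSum smallSum contribution : Fin s → ℚ.ℚ
      chainSum i = sumFin (λ (j : Fin (suc m)) → ℕ→ℚ (n C toℕ j) ℚ.* β (F i) (Ch i j))
      smallSum i = sumList (map (λ S → frac (n C (m + ∣ S ∣)) (r C ∣ S ∣) ℚ.* β (F i) (H i ∪ S)) (smallSubsets R))
      contribution i = chainSum i ℚ.+ smallSum i

      Ch⊆H : ∀ i j → Ch i j ⊆ H i
      Ch⊆H i j = subst (Ch i j ⊆_) (Ch-top i) (chain⊆last (Ch i) (λ j → p⊂q⇒p⊆q (Ch-step i j)) j)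

      chainSum≤ : ∀ i → chainSum i ℚ.≤ ℕ→ℚ (⟦ owns i ⟧ * G)
      chainSum≤ i = sumFin-≤-ℕ (λ j → ℕ→ℚ (n C toℕ j) ℚ.* β (F i) (Ch i j)) (λ j → (n C toℕ j) * ⟦ F i (Ch i j) ⟧) (⟦ owns i ⟧ * G)
        (λ j → ℚ.≤-reflexive (ℕ→ℚ-*-indicator (n C toℕ j) (F i (Ch i j)))) (begin
          ∑[ j < suc m ] ((n C toℕ j) * ⟦ F i (Ch i j) ⟧)
            ≤⟨ ∑-mono-≤ (λ j → *-monoʳ-≤ (n C toℕ j) (⟦⟧-mono (up i (Ch i j) (H i) (Ch⊆H i j)))) ⟩
          ∑[ j < suc m ] ((n C toℕ j) * ⟦ owns i ⟧)  ≡⟨ sym (*-distribʳ-sum {suc m} ⟦ owns i ⟧ (λ j → n C toℕ j)) ⟩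
          (∑[ j < suc m ] (n C toℕ j)) * ⟦ owns i ⟧ ≡⟨ cong (_* ⟦ owns i ⟧) (sym G≡∑) ⟩
          G * ⟦ owns i ⟧                          ≡⟨ *-comm G ⟦ owns i ⟧ ⟩
          ⟦ owns i ⟧ * G                          ∎)
        where open ≤-Reasoning

      small? : (S : Subset n) → Dec (Small R S)
      small? S = (S ⊆? R) ×-dec ((∣ S ∣ ℕ.≟ 1) ⊎-dec (∣ S ∣ ℕ.≟ 2))

      w₂ : ℚ.ℚ
      w₂ = frac (n C (m + 2)) (r C 2)

      rC2≢0 : r C 2 ≢ 0
      rC2≢0 eq = 0≢1+n (sym (trans (sym (nC1≡n (1 + t))) (m+n≡0⇒m≡0 _ (trans (sym (C-pascal (1 + t) 1)) eq))))

      small-term≤-by-size : ∀ k b → k ≡ 1 ⊎ k ≡ 2 →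
        frac (n C (m + k)) (r C k) ℚ.* (if b then ℚ.1ℚ else ℚ.0ℚ)
          ℚ.≤ ℕ→ℚ (c * ⟦ does (k ℕ.≟ 1) ∧ b ⟧) ℚ.+ w₂ ℚ.* ℕ→ℚ ⟦ does (k ℕ.≟ 2) ⟧
      small-term≤-by-size .1 b (inj₁ refl) = ℚ.≤-reflexive (trans (cong (ℚ._* (if b then ℚ.1ℚ else ℚ.0ℚ)) weight₁)
        (trans (ℕ→ℚ-*-indicator c b) (sym (trans (cong (ℕ→ℚ (c * ⟦ b ⟧) ℚ.+_) (ℚ.*-zeroʳ w₂)) (ℚ.+-identityʳ _)))))
        where
        weight₁ : frac (n C (m + 1)) (r C 1) ≡ ℕ→ℚ c
        weight₁ = trans (cong₂ frac C[n,m+1]≡r*c (nC1≡n r)) (frac-cancel (1 + t) c)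
      small-term≤-by-size .2 b (inj₂ refl) = ℚ.≤-trans (*-indicator-≤ w₂ b (frac-nonNeg (n C (m + 2)) (r C 2)))
        (ℚ.≤-reflexive (sym (trans (cong (ℚ._+ w₂ ℚ.* ℚ.1ℚ) (cong ℕ→ℚ (*-zeroʳ c)))
                                   (trans (ℚ.+-identityˡ _) (ℚ.*-identityʳ w₂)))))

      small-term≤ : ∀ i S → Small R S →
        frac (n C (m + ∣ S ∣)) (r C ∣ S ∣) ℚ.* β (F i) (H i ∪ S)
          ℚ.≤ ℕ→ℚ (c * ⟦ does (∣ S ∣ ℕ.≟ 1) ∧ F i (H i ∪ S) ⟧) ℚ.+ w₂ ℚ.* ℕ→ℚ ⟦ does (∣ S ∣ ℕ.≟ 2) ⟧
      small-term≤ i S (_ , size) = small-term≤-by-size ∣ S ∣ (F i (H i ∪ S)) size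

      #small-pairs : sumℕ (map (λ S → ⟦ does (∣ S ∣ ℕ.≟ 2) ⟧) (smallSubsets R)) ≡ r C 2
      #small-pairs = begin
        sumℕ (map (λ S → ⟦ does (∣ S ∣ ℕ.≟ 2) ⟧) (smallSubsets R))
          ≡⟨ sumℕ-filter small? _ (allSubsets n) ⟩
        sumℕ (map (λ S → if does (small? S) then ⟦ does (∣ S ∣ ℕ.≟ 2) ⟧ else 0) (allSubsets n))
          ≡⟨ cong sumℕ (map-cong (λ S → restrict (does (S ⊆? R)) (does (∣ S ∣ ℕ.≟ 1)) (does (∣ S ∣ ℕ.≟ 2))) (allSubsets n)) ⟩
        sumℕ (map (λ S → ⟦ does (S ⊆? R) ∧ does (∣ S ∣ ℕ.≟ 2) ⟧) (allSubsets n))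
          ≡⟨ #subsets-of-size R 2 ⟩
        ∣ R ∣ C 2
          ≡⟨ cong (_C 2) ∣R∣≡r ⟩
        r C 2 ∎
        where
        open ≡-Reasoning
        restrict : ∀ b o p → (if b ∧ (o ∨ p) then ⟦ p ⟧ else 0) ≡ ⟦ b ∧ p ⟧
        restrict false _ _ = refl
        restrict true true false = refl
        restrict true true true = refl
        restrict true false true = refl
        restrict true false false = refl

      small-singletons : ∀ i → sumℕ (map (λ S → c * ⟦ does (∣ S ∣ ℕ.≟ 1) ∧ F i (H i ∪ S) ⟧) (smallSubsets R))
                                 ≡ c * live i inR
      small-singletons i = begin
        sumℕ (map (λ S → c * ⟦ does (∣ S ∣ ℕ.≟ 1) ∧ a S ⟧) (smallSubsets R))
          ≡⟨ sumℕ-filter small? _ (allSubsets n) ⟩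
        sumℕ (map (λ S → if does (small? S) then c * ⟦ does (∣ S ∣ ℕ.≟ 1) ∧ a S ⟧ else 0) (allSubsets n))
          ≡⟨ cong sumℕ (map-cong (λ S → restrict (does (S ⊆? R)) (does (∣ S ∣ ℕ.≟ 1)) (does (∣ S ∣ ℕ.≟ 2)) (a S))
                                 (allSubsets n)) ⟩
        sumℕ (map (λ S → if does (S ⊆? R) ∧ does (∣ S ∣ ℕ.≟ 1) then c * ⟦ a S ⟧ else 0) (allSubsets n))
          ≡⟨ sum-over-singletons R (λ S → c * ⟦ a S ⟧) ⟩
        ∑[ x < n ] (if inR x then c * ⟦ alive i x ⟧ else 0)
          ≡⟨ sum-cong-≗ (λ x → pull-out (inR x) (alive i x)) ⟩
        ∑[ x < n ] (c * ⟦ inR x ∧ alive i x ⟧)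
          ≡⟨ sym (*-distribˡ-sum c (λ x → ⟦ inR x ∧ alive i x ⟧)) ⟩
        c * live i inR ∎
        where
        open ≡-Reasoning
        a : Subset n → Bool
        a S = F i (H i ∪ S)
        restrict : ∀ b o p x → (if b ∧ (o ∨ p) then c * ⟦ o ∧ x ⟧ else 0) ≡ (if b ∧ o then c * ⟦ x ⟧ else 0)
        restrict false _ _ _ = refl
        restrict true true _ _ = refl
        restrict true false true _ = *-zeroʳ c
        restrict true false false _ = refl
        pull-out : ∀ b x → (if b then c * ⟦ x ⟧ else 0) ≡ c * ⟦ b ∧ x ⟧
        pull-out true x = refl
        pull-out false x = sym (*-zeroʳ c)

      smallSum≤ : ∀ i → smallSum i ℚ.≤ ℕ→ℚ (c * live i inR + P)
      smallSum≤ i = begin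
        smallSum i
          ≤⟨ sumList-mono-≤ (All.map (λ {S} → small-term≤ i S) (all-filter small? (allSubsets n))) ⟩
        sumList (map (λ S → ℕ→ℚ (one S) ℚ.+ w₂ ℚ.* ℕ→ℚ (two S)) (smallSubsets R))
          ≡⟨ sumList-ℕ→ℚ-linear one two w₂ (smallSubsets R) ⟩
        ℕ→ℚ (sumℕ (map one (smallSubsets R))) ℚ.+ w₂ ℚ.* ℕ→ℚ (sumℕ (map two (smallSubsets R)))
          ≡⟨ cong₂ (λ u v → ℕ→ℚ u ℚ.+ w₂ ℚ.* ℕ→ℚ v) (small-singletons i) #small-pairs ⟩
        ℕ→ℚ (c * live i inR) ℚ.+ w₂ ℚ.* ℕ→ℚ (r C 2)
          ≡⟨ cong (ℕ→ℚ (c * live i inR) ℚ.+_) (trans (frac-*-denominator (n C (m + 2)) (r C 2) rC2≢0)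
                                                    (cong ℕ→ℚ C[n,m+2]≡P)) ⟩
        ℕ→ℚ (c * live i inR) ℚ.+ ℕ→ℚ P
          ≡⟨ sym (ℕ→ℚ-+ (c * live i inR) P) ⟩
        ℕ→ℚ (c * live i inR + P) ∎
        where
        open ℚ.≤-Reasoning
        one two : Subset n → ℕ
        one S = c * ⟦ does (∣ S ∣ ℕ.≟ 1) ∧ F i (H i ∪ S) ⟧
        two S = ⟦ does (∣ S ∣ ℕ.≟ 2) ⟧

      smallSum-hopeless : ∀ i → All (λ S → F i (H i ∪ S) ≡ false) (smallSubsets R) → smallSum i ≡ ℚ.0ℚ
      smallSum-hopeless i hopeless = sumList-map-zero (All.map (λ {S} F≡false →
        trans (cong (λ b → frac (n C (m + ∣ S ∣)) (r C ∣ S ∣) ℚ.* (if b then ℚ.1ℚ else ℚ.0ℚ)) F≡false)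
              (ℚ.*-zeroʳ (frac (n C (m + ∣ S ∣)) (r C ∣ S ∣)))) hopeless)

      contribution≤ : ∀ i → contribution i ℚ.≤ ℕ→ℚ (⟦ owns i ⟧ * G + (c * live i inR + P))
      contribution≤ i = ℚ.≤-trans (ℚ.+-mono-≤ (chainSum≤ i) (smallSum≤ i))
                                  (ℚ.≤-reflexive (sym (ℕ→ℚ-+ (⟦ owns i ⟧ * G) _)))

      target : ℕ
      target = s * (r * c + P)

      c*live≤r*c : ∀ i → c * live i inR ≤ r * c
      c*live≤r*c i = subst (c * live i inR ≤_) (*-comm c r) (*-monoʳ-≤ c (live≤r i))

      hopeless-case : ∀ z → deficient z ≡ true → All (λ S → F z (H z ∪ S) ≡ false) (smallSubsets R) →
                      sumFin contribution ℚ.≤ ℕ→ℚ target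
      hopeless-case z dz hopeless = sumFin-≤-ℕ contribution ((λ _ → K) without z) target bound (begin
        sum ((λ _ → K) without z) ≡⟨ +-cancelˡ-≡ K (sum ((λ _ → K) without z)) (r * K) (trans (sym (∑-pick (λ _ → K) z)) (∑-const s K)) ⟩
        r * K                     ≤⟨ r*[G+r*c+P]≤s*[r*c+P] ⟩
        target                    ∎)
        where
        open ≤-Reasoning
        K : ℕ
        K = G + (r * c + P)
        contribution-z≡0 : contribution z ℚ.≤ ℚ.0ℚ
        contribution-z≡0 = ℚ.≤-trans
          (ℚ.+-mono-≤ (subst (λ b → chainSum z ℚ.≤ ℕ→ℚ (⟦ b ⟧ * G)) (not-injective dz) (chainSum≤ z))
                      (ℚ.≤-reflexive (smallSum-hopeless z hopeless)))
          (ℚ.≤-reflexive (ℚ.+-identityʳ ℚ.0ℚ))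
        bound : ∀ i → contribution i ℚ.≤ ℕ→ℚ (((λ _ → K) without z) i)
        bound i with i ≟ z
        ... | yes refl = contribution-z≡0
        ... | no _ = ℚ.≤-trans (contribution≤ i)
          (ℕ→ℚ-mono-≤ {⟦ owns i ⟧ * G + (c * live i inR + P)} {K} (+-mono-≤ (⟦⟧*-≤ (owns i) G) (+-monoˡ-≤ P (c*live≤r*c i))))

      many-deficient-case : 2 ≤ count deficient → sumFin contribution ℚ.≤ ℕ→ℚ target
      many-deficient-case 2≤#d = sumFin-≤-ℕ contribution B target contribution≤ (+-cancelˡ-≤ (c * D) (sum B) target (begin
        c * D + sum B                               ≡⟨ +-comm (c * D) (sum B) ⟩
        sum B + c * D                               ≡⟨ cong (sum B +_) (*-distribˡ-sum c (λ i → d i)) ⟩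
        sum B + ∑[ i < s ] (c * d i)                ≡⟨ sym (∑-distrib-+ B (λ i → c * d i)) ⟩
        ∑[ i < s ] (B i + c * d i)                  ≤⟨ ∑-mono-≤ pointwise ⟩
        ∑[ i < s ] (⟦ owns i ⟧ * G + (r * c + P))   ≡⟨ ∑-distrib-+ (λ i → ⟦ owns i ⟧ * G) (λ _ → r * c + P) ⟩
        ∑[ i < s ] (⟦ owns i ⟧ * G) + ∑[ i < s ] (r * c + P)
          ≡⟨ cong₂ _+_ (sym (*-distribʳ-sum G (λ i → ⟦ owns i ⟧))) (∑-const s (r * c + P)) ⟩
        count owns * G + target                     ≤⟨ +-monoˡ-≤ target owners≤ ⟩
        c * D + target                              ∎))
        where
        open ≤-Reasoning
        D : ℕ
        D = deficit deficient inR
        d B : Fin s → ℕ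
        d i = if deficient i then dead i inR else 0
        B i = ⟦ owns i ⟧ * G + (c * live i inR + P)

        pointwise : ∀ i → B i + c * d i ≤ ⟦ owns i ⟧ * G + (r * c + P)
        pointwise i = begin
          (⟦ owns i ⟧ * G + (c * live i inR + P)) + c * d i
            ≡⟨ solve 4 (λ a x y p → (a :+ (x :+ p)) :+ y := a :+ ((x :+ y) :+ p)) refl (⟦ owns i ⟧ * G) (c * live i inR) (c * d i) P ⟩
          ⟦ owns i ⟧ * G + ((c * live i inR + c * d i) + P)
            ≤⟨ +-monoʳ-≤ (⟦ owns i ⟧ * G) (+-monoˡ-≤ P
                 (*-split-≤ c (live i inR) (dead i inR) (d i) (trans (live+dead i inR) #R≡r) (if-≤ (deficient i)))) ⟩
          ⟦ owns i ⟧ * G + (r * c + P)                      ∎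

        owners≤ : count owns * G ≤ c * D
        owners≤ with count owns in #o
        ... | zero = z≤n
        ... | suc k = begin
          suc k * G   ≤⟨ *-monoˡ-≤ G few-owners ⟩
          (1 + t) * G ≤⟨ [r∸1]*G≤r*c ⟩
          r * c       ≤⟨ *-monoˡ-≤ c r≤D ⟩
          D * c       ≡⟨ *-comm D c ⟩
          c * D       ∎
          where
          sum≡s : suc k + count deficient ≡ s
          sum≡s = trans (cong (_+ count deficient) (sym #o)) (count+count-not owns)
          few-owners : suc k ≤ 1 + t
          few-owners = +-cancelʳ-≤ 2 (suc k) (1 + t)
            (≤-trans (+-monoʳ-≤ (suc k) 2≤#d) (≤-reflexive (trans sum≡s (+-comm 2 (1 + t)))))
          #d≤r : count deficient ≤ r
          #d≤r = s≤s⁻¹ (≤-trans (+-monoˡ-≤ (count deficient) (s≤s (z≤n {k}))) (≤-reflexive sum≡s))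
          r≤D : r ≤ D
          r≤D = subst (_≤ D) #R≡r (hall deficient inR (≤-trans (s≤s z≤n) 2≤#d)
                                        (subst (count deficient ≤_) (sym #R≡r) #d≤r) deficient-unmatchable)

      extension : ¬ (∃ λ z → deficient z ≡ true × All (λ S → F z (H z ∪ S) ≡ false) (smallSubsets R)) →
                  ∀ i → deficient i ≡ true → Σ (Subset n) (Extension i)
      extension no-hopeless i di
        with ¬All⇒Any¬ (λ S → F i (H i ∪ S) ≟ᵇ false) (smallSubsets R) (λ hopeless → no-hopeless (i , di , hopeless))
      ... | some-alive with All.lookupAny (all-filter small? (allSubsets n)) some-alive
      ...   | (S⊆R , _) , F≢false = Any.lookup some-alive , S⊆R , ¬-not F≢false

      Hopeless : Fin s → Set
      Hopeless z = deficient z ≡ true × All (λ S → F z (H z ∪ S) ≡ false) (smallSubsets R)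

      hopeless? : ∀ z → Dec (Hopeless z)
      hopeless? z = (deficient z ≟ᵇ true) ×-dec all? (λ S → F z (H z ∪ S) ≟ᵇ false) (smallSubsets R)

      contribution-sum≤ : sumFin contribution ℚ.≤ ℕ→ℚ target
      contribution-sum≤ = by-cases (any? hopeless?) (count deficient ℕ.≤? 1)
        where
        by-cases : Dec (∃ Hopeless) → Dec (count deficient ≤ 1) → sumFin contribution ℚ.≤ ℕ→ℚ target
        by-cases (yes (z , dz , hopeless)) _ = hopeless-case z dz hopeless
        by-cases (no no-hopeless) (yes #d≤1) = ⊥-elim (at-most-one-deficient⇒⊥ (extension no-hopeless) #d≤1)
        by-cases (no _) (no #d≰1) = many-deficient-case (≰⇒> #d≰1)

      theorem : sumFin contribution ℚ.≤ ℕ→ℚ (s * (n C (m + 1)) + s * (n C (m + 2)))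
      theorem = subst (λ N → sumFin contribution ℚ.≤ ℕ→ℚ N)
        (trans (*-distribˡ-+ s (r * c) P) (cong₂ (λ x y → s * x + s * y) (sym C[n,m+1]≡r*c) (sym C[n,m+2]≡P)))
        contribution-sum≤


open import Defs
open import Data.Nat using (ℕ; suc; _≤_; _∸_; s≤s) renaming (_+_ to _+ℕ_; _*_ to _*ℕ_)
open import Data.Nat.Combinatorics using (_C_)
open import Data.Rational using (_+_; _*_) renaming (_≤_ to _≤ℚ_)
open import Data.Fin using (Fin; zero; suc; fromℕ; inject₁; toℕ)
open import Data.Fin.Subset using (Subset; _⊂_; _∩_; _∪_; Empty; ∁; ∣_∣; ⊥)
open import Data.List using (map)
open import Relation.Binary.PropositionalEquality using (_≡_; _≢_; refl)

lemma4 : (s m n : ℕ) → 3 ≤ s → 1 ≤ m → n ≡ s *ℕ m +ℕ (s ∸ 1) →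
    (F : Fin s → Family n) → (∀ i → UpSet (F i)) → CrossDependent F →
    (H : Fin s → Subset n) → (∀ i → ∣ H i ∣ ≡ m) →
    (∀ i j → i ≢ j → Empty (H i ∩ H j)) →
    (Ch : Fin s → Fin (suc m) → Subset n) →
    (∀ i → Ch i zero ≡ ⊥) → (∀ i → Ch i (fromℕ m) ≡ H i) →
    (∀ i (j : Fin m) → Ch i (inject₁ j) ⊂ Ch i (suc j)) →
    sumFin (λ i →
        sumFin (λ (j : Fin (suc m)) → ℕ→ℚ (n C (toℕ j)) * β (F i) (Ch i j))
      + sumList (map (λ S → frac (n C (m +ℕ ∣ S ∣)) ((s ∸ 1) C ∣ S ∣) * β (F i) (H i ∪ S))
                     (smallSubsets (∁ (⋃Fin H)))))
    ≤ℚ ℕ→ℚ (s *ℕ (n C (m +ℕ 1)) +ℕ s *ℕ (n C (m +ℕ 2)))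
lemma4 (suc (suc (suc t))) (suc m′) _ (s≤s (s≤s (s≤s _))) (s≤s _) refl F up cd H ∣H∣≡m H-disjoint Ch _ Ch-top Ch-step =
  Proof.Setting.Agents.theorem t m′ F up cd H ∣H∣≡m H-disjoint Ch Ch-top Ch-step
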